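{- Let $n \geq 1$ be an integer. Then there exist rational numbers $c_0, c_1, \ldots, c_{n-1}$, independent of $m$, such that for every integer $m \geq 0$, $$B_n^{(m)} = c_{n-1}m^{n-1} + c_{n-2}m^{n-2} + \cdots + c_1 m + c_0.$$
   Context: For integers $m,n \geq 0$, the $m$-th order Bell numbers $B_n^{(m)}$ are defined by the exponential generating functions $E_m(x) = \sum_{n=0}^\infty B_n^{(m)} \frac{x^n}{n!}$, where $E_0(x) = \exp(x)$ and $E_{m+1}(x) = \exp(E_m(x) - 1)$ for $m \geq 0$. In particular $B_n^{(1)}$ are the ordinary Bell numbers. -}

module Defs where

open import Data.Nat as ℕ using (ℕ; zero; suc; _!; _∸_)
open import Data.Nat.Properties using (_!≢0)
open import Data.Fin using (Fin; toℕ)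
import Data.Fin as Fin
open import Data.Integer using (+_)
open import Data.Rational using (ℚ; 0ℚ; 1ℚ; _+_; _*_; _-_; _/_)

-- Formal power series over ℚ, given by their (ordinary) coefficient sequences.
Series : Set
Series = ℕ → ℚ

Σ< : ℕ → (ℕ → ℚ) → ℚ
Σ< zero    f = 0ℚ
Σ< (suc n) f = Σ< n f + f n

ΣFin : (n : ℕ) → (Fin n → ℚ) → ℚ
ΣFin zero    f = 0ℚ
ΣFin (suc n) f = f Fin.zero + ΣFin n (λ i → f (Fin.suc i))

ℕ→ℚ : ℕ → ℚ
ℕ→ℚ n = + n / 1

invFact : ℕ → ℚ
invFact k = + 1 / (k !)
  where instance _ = k !≢0

oneS : Series
oneS zero    = 1ℚ
oneS (suc n) = 0ℚ

_·S_ : Series → Series → Series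
(f ·S g) n = Σ< (suc n) (λ i → f i * g (n ∸ i))

_−S_ : Series → Series → Series
(f −S g) n = f n - g n

powS : Series → ℕ → Series
powS f zero    = oneS
powS f (suc k) = f ·S powS f k

-- exp(f) = Σ_k f^k / k!  (as a formal series; used only for f with zero
-- constant term, where [x^n] exp(f) = Σ_{k ≤ n} [x^n] f^k / k!)
expS : Series → Series
expS f n = Σ< (suc n) (λ k → invFact k * powS f k n)

E : ℕ → Series
E zero    n = invFact n
E (suc m) = expS (E m −S oneS)

Bell : (m n : ℕ) → ℚ
Bell m n = ℕ→ℚ (n !) * E m n

module Submission where

-- Write F_m = E_m − 1, so that E_{m+1} = exp(F_m) and [x^0] F_m = 0.  We say
-- that a function f : ℕ → ℚ has degree < d ("Poly< d f") when its d-th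
-- forward difference vanishes.  This class is closed under sums and scalar
-- multiples, and degrees add under products (Leibniz rule for Δ).  Hence, if
-- every coefficient [x^j] F_m has degree < j (as a function of m), then
-- [x^n] F_m^k has degree ≤ n − k ("weights add under the Cauchy product").
-- Since Δ_m [x^{n+1}] F_m = Σ_{k ≥ 2} [x^{n+1}] F_m^k / k!, strong induction
-- on n shows that [x^n] F_m, hence [x^n] E_m and B_n^{(m)} = n! [x^n] E_m,
-- has degree < n for n ≥ 1.
--
-- Finally Newton's forward-difference formula f(m) = Σ_{i<n} Δ^i f(0)·C(m,i)
-- and the fact that each C(m,i) is an explicit polynomial in m of degree ≤ i
-- turn "degree < n" into the monomial form required by the statement.

open import Defs
open import Data.Nat using (ℕ; _≤_; _^_)
open import Data.Fin using (Fin; toℕ)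
open import Data.Product using (Σ)
open import Data.Rational using (ℚ; _*_)
open import Relation.Binary.PropositionalEquality using (_≡_)

open import Algebra.Bundles using (CommutativeRing)
open import Data.Nat as ℕ using (zero; suc; _<_; _∸_; z≤n; s≤s; _!)
import Data.Nat.Properties as ℕP
open import Data.Nat.Combinatorics using (_C_; nC1≡n; nCk+nC[k+1]≡[n+1]C[k+1])
open import Data.Nat.Tactic.RingSolver using (solve-∀)
import Data.Nat.Coprimality as Coprime
import Data.Integer.Properties as ℤP
import Data.Integer as ℤ
import Data.Fin.Base as Fin using (zero; suc)
open import Data.Fin.Properties using (toℕ<n)
open import Data.Vec.Functional using (_∷_)
open import Data.Rational using (0ℚ; 1ℚ; _+_; _-_; -_; mkℚ; 1/_)
open import Data.Rational.Properties
  using (+-*-commutativeRing; normalize-coprime; /-cong; *-inverseˡ; +-inverseʳ;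
         *-zeroˡ; *-zeroʳ; *-assoc; *-distribʳ-+)
open import Data.Rational.Solver using (module +-*-Solver)
open +-*-Solver using (solve; _:+_; _:*_; _:-_; :-_; _:=_; con)
open import Algebra.Properties.Semiring.Sum (CommutativeRing.semiring +-*-commutativeRing)
  using (sum; sum-cong-≗; sum-replicate-zero; ∑-distrib-+; *-distribˡ-sum)
open import Data.Product using (_,_)
open import Data.Sum using (inj₁; inj₂)
open import Relation.Nullary using (yes; no)
open import Relation.Binary.PropositionalEquality
  using (refl; sym; trans; cong; cong₂; subst; subst₂; module ≡-Reasoning)

Fn : Set
Fn = ℕ → ℚ

ℕ→ℚ≡mkℚ : ∀ n → ℕ→ℚ n ≡ mkℚ (ℤ.+ n) 0 (Coprime.sym (Coprime.1-coprimeTo n))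
ℕ→ℚ≡mkℚ n = normalize-coprime (Coprime.sym (Coprime.1-coprimeTo n))

ℕ→ℚ-+ : ∀ a b → ℕ→ℚ (a ℕ.+ b) ≡ ℕ→ℚ a + ℕ→ℚ b
ℕ→ℚ-+ a b rewrite ℕ→ℚ≡mkℚ a | ℕ→ℚ≡mkℚ b = sym (/-cong {q₁ = 1} {q₂ = 1} numerators refl)
  where
  numerators : ℤ.+ a ℤ.* ℤ.+ 1 ℤ.+ ℤ.+ b ℤ.* ℤ.+ 1 ≡ ℤ.+ (a ℕ.+ b)
  numerators rewrite ℤP.*-identityʳ (ℤ.+ a) | ℤP.*-identityʳ (ℤ.+ b) = sym (ℤP.pos-+ a b)

ℕ→ℚ-* : ∀ a b → ℕ→ℚ (a ℕ.* b) ≡ ℕ→ℚ a * ℕ→ℚ b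
ℕ→ℚ-* a b rewrite ℕ→ℚ≡mkℚ a | ℕ→ℚ≡mkℚ b =
  sym (/-cong {q₁ = 1} {q₂ = 1} (sym (ℤP.pos-* a b)) refl)

ℕ→ℚ-suc-invertible : ∀ i → Σ ℚ λ r → r * ℕ→ℚ (suc i) ≡ 1ℚ
ℕ→ℚ-suc-invertible i rewrite ℕ→ℚ≡mkℚ (suc i) = 1/ q , *-inverseˡ q
  where
  q : ℚ
  q = mkℚ (ℤ.+ suc i) 0 (Coprime.sym (Coprime.1-coprimeTo (suc i)))

Σ<-head : ∀ n (f : ℕ → ℚ) → Σ< (suc n) f ≡ f 0 + Σ< n (λ i → f (suc i))
Σ<-head zero f = solve 1 (λ a → con 0ℚ :+ a := a :+ con 0ℚ) refl (f 0)
Σ<-head (suc n) f rewrite Σ<-head n f =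
  solve 3 (λ a b c → (a :+ b) :+ c := a :+ (b :+ c)) refl
    (f 0) (Σ< n (λ i → f (suc i))) (f (suc n))

Σ<-zero : ∀ n {f : ℕ → ℚ} → (∀ i → i < n → f i ≡ 0ℚ) → Σ< n f ≡ 0ℚ
Σ<-zero zero    _ = refl
Σ<-zero (suc n) h = cong₂ _+_ (Σ<-zero n (λ i i<n → h i (ℕP.m<n⇒m<1+n i<n))) (h n ℕP.≤-refl)

ΣFin≡sum : ∀ n (f : Fin n → ℚ) → ΣFin n f ≡ sum f
ΣFin≡sum zero    f = refl
ΣFin≡sum (suc n) f = cong (f Fin.zero +_) (ΣFin≡sum n (λ i → f (Fin.suc i)))

sum-zero : ∀ n {f : Fin n → ℚ} → (∀ i → f i ≡ 0ℚ) → sum f ≡ 0ℚ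
sum-zero n h = trans (sum-cong-≗ h) (sum-replicate-zero n)

Δ : Fn → Fn
Δ f m = f (suc m) - f m

Δ^ : ℕ → Fn → Fn
Δ^ zero    f = f
Δ^ (suc i) f = Δ^ i (Δ f)

Poly< : ℕ → Fn → Set
Poly< zero    f = ∀ m → f m ≡ 0ℚ
Poly< (suc d) f = Poly< d (Δ f)

Poly<-cong : ∀ d {f g : Fn} → (∀ m → f m ≡ g m) → Poly< d f → Poly< d g
Poly<-cong zero    f≗g p m = trans (sym (f≗g m)) (p m)
Poly<-cong (suc d) f≗g p   = Poly<-cong d (λ m → cong₂ _-_ (f≗g (suc m)) (f≗g m)) p

Poly<-zero : ∀ d {f : Fn} → (∀ m → f m ≡ 0ℚ) → Poly< d f
Poly<-zero zero    f≗0 = f≗0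
Poly<-zero (suc d) f≗0 = Poly<-zero d (λ m → cong₂ _-_ (f≗0 (suc m)) (f≗0 m))

Poly<-mono : ∀ {d e} {f : Fn} → d ≤ e → Poly< d f → Poly< e f
Poly<-mono {e = e} z≤n     p = Poly<-zero e p
Poly<-mono         (s≤s d≤e) p = Poly<-mono d≤e p

Poly<-const : ∀ a → Poly< 1 (λ _ → a)
Poly<-const a m = +-inverseʳ a

Poly<-+ : ∀ d {f g : Fn} → Poly< d f → Poly< d g → Poly< d (λ m → f m + g m)
Poly<-+ zero    p q m = cong₂ _+_ (p m) (q m)
Poly<-+ (suc d) {f} {g} p q = Poly<-cong d Δ-+ (Poly<-+ d p q)
  where
  Δ-+ : ∀ m → Δ f m + Δ g m ≡ Δ (λ k → f k + g k) m
  Δ-+ m = solve 4 (λ a b c e → (a :- c) :+ (b :- e) := (a :+ b) :- (c :+ e)) refl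
            (f (suc m)) (g (suc m)) (f m) (g m)

Poly<-scale : ∀ d a {f : Fn} → Poly< d f → Poly< d (λ m → a * f m)
Poly<-scale zero    a p m = trans (cong (a *_) (p m)) (*-zeroʳ a)
Poly<-scale (suc d) a {f} p = Poly<-cong d Δ-scale (Poly<-scale d a p)
  where
  Δ-scale : ∀ m → a * Δ f m ≡ Δ (λ k → a * f k) m
  Δ-scale m = solve 3 (λ a b c → a :* (b :- c) := a :* b :- a :* c) refl a (f (suc m)) (f m)

Poly<-shift : ∀ d {f : Fn} → Poly< d f → Poly< d (λ m → f (suc m))
Poly<-shift zero    p m = p (suc m)
Poly<-shift (suc d) p   = Poly<-shift d p

Poly<-Σ< : ∀ d k {h : ℕ → Fn} → (∀ i → i < k → Poly< d (h i)) →
  Poly< d (λ m → Σ< k (λ i → h i m))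
Poly<-Σ< d zero    _ = Poly<-zero d (λ _ → refl)
Poly<-Σ< d (suc k) H =
  Poly<-+ d (Poly<-Σ< d k (λ i i<k → H i (ℕP.m<n⇒m<1+n i<k))) (H k ℕP.≤-refl)

Poly<-zero-*ˡ : ∀ {d} {f g : Fn} → Poly< 0 f → Poly< d (λ m → f m * g m)
Poly<-zero-*ˡ {d} {g = g} f≗0 = Poly<-zero d (λ m → trans (cong (_* g m) (f≗0 m)) (*-zeroˡ (g m)))

Poly<-zero-*ʳ : ∀ {d} {f g : Fn} → Poly< 0 g → Poly< d (λ m → f m * g m)
Poly<-zero-*ʳ {d} {f} g≗0 = Poly<-zero d (λ m → trans (cong (f m *_) (g≗0 m)) (*-zeroʳ (f m)))

Δ-* : ∀ (f g : Fn) m → Δ (λ k → f k * g k) m ≡ Δ f m * g (suc m) + f m * Δ g m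
Δ-* f g m = solve 4 (λ a b c e → a :* b :- c :* e := (a :- c) :* b :+ c :* (b :- e)) refl
              (f (suc m)) (g (suc m)) (f m) (g m)

-- By Leibniz both terms of Δ(fg) have degree ≤ a + b − 1, by recursion on a
-- (resp. b); when a = 0 (resp. b = 0) the term contains Δf = 0 (resp. Δg = 0).
Poly<-* : ∀ a b {f g : Fn} → Poly< (suc a) f → Poly< (suc b) g →
  Poly< (suc (a ℕ.+ b)) (λ m → f m * g m)
Poly<-* a b {f} {g} pf pg =
  Poly<-cong (a ℕ.+ b) (λ m → sym (Δ-* f g m)) (Poly<-+ (a ℕ.+ b) (left a pf) (right b pg))
  where
  left : ∀ a → Poly< (suc a) f → Poly< (a ℕ.+ b) (λ m → Δ f m * g (suc m))
  left zero     pf = Poly<-zero-*ˡ {b} {Δ f} {λ m → g (suc m)} pf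
  left (suc a′) pf = Poly<-* a′ b {Δ f} {λ m → g (suc m)} pf (Poly<-shift (suc b) {g} pg)
  right : ∀ b → Poly< (suc b) g → Poly< (a ℕ.+ b) (λ m → f m * Δ g m)
  right zero     pg = Poly<-zero-*ʳ {a ℕ.+ 0} {f} {Δ g} pg
  right (suc b′) pg = subst (λ d → Poly< d (λ m → f m * Δ g m)) (sym (ℕP.+-suc a b′))
                        (Poly<-* a b′ {f} {Δ g} pf pg)

pascal : ∀ m i → ℕ→ℚ (suc m C suc i) ≡ ℕ→ℚ (m C i) + ℕ→ℚ (m C suc i)
pascal m i = trans (cong ℕ→ℚ (sym (nCk+nC[k+1]≡[n+1]C[k+1] m i))) (ℕ→ℚ-+ (m C i) (m C suc i))

-- Newton's formula f(m) = Σ_{i<n} Δ^i f(0)·C(m,i) for f of degree < n, by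
-- induction on m: f(m+1) = f(m) + Δf(m) and Pascal's rule.
newton : ∀ n (f : Fn) → Poly< n f →
  ∀ m → f m ≡ sum {n} (λ i → Δ^ (toℕ i) f 0 * ℕ→ℚ (m C toℕ i))
newton zero    f p m = p m
newton (suc n) f p zero =
  trans (solve 1 (λ a → a := a :* con 1ℚ :+ con 0ℚ) refl (f 0))
        (cong (f 0 * 1ℚ +_) (sym (sum-zero n (λ i → *-zeroʳ (Δ^ (suc (toℕ i)) f 0)))))
newton (suc n) f p (suc m) = begin
    f (suc m)
  ≡⟨ solve 2 (λ a b → b := a :+ (b :- a)) refl (f m) (f (suc m)) ⟩
    f m + Δ f m
  ≡⟨ cong₂ _+_ (newton (suc n) f p m) (newton n (Δ f) p m) ⟩
    (f 0 * 1ℚ + sum (λ i → c i * C′ m (suc (toℕ i)))) + sum (λ i → c i * C′ m (toℕ i))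
  ≡⟨ solve 3 (λ a b e → (a :+ b) :+ e := a :+ (b :+ e)) refl
       (f 0 * 1ℚ) (sum (λ i → c i * C′ m (suc (toℕ i)))) (sum (λ i → c i * C′ m (toℕ i))) ⟩
    f 0 * 1ℚ + (sum (λ i → c i * C′ m (suc (toℕ i))) + sum (λ i → c i * C′ m (toℕ i)))
  ≡⟨ cong (f 0 * 1ℚ +_)
          (sym (∑-distrib-+ (λ i → c i * C′ m (suc (toℕ i))) (λ i → c i * C′ m (toℕ i)))) ⟩
    f 0 * 1ℚ + sum (λ i → c i * C′ m (suc (toℕ i)) + c i * C′ m (toℕ i))
  ≡⟨ cong (f 0 * 1ℚ +_) (sum-cong-≗ (λ i → pascal-term (c i) (toℕ i))) ⟩
    f 0 * 1ℚ + sum (λ i → c i * C′ (suc m) (suc (toℕ i)))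
  ∎
  where
  open ≡-Reasoning
  C′ : ℕ → ℕ → ℚ
  C′ m i = ℕ→ℚ (m C i)
  c : Fin n → ℚ
  c i = Δ^ (suc (toℕ i)) f 0
  pascal-term : ∀ a i → a * C′ m (suc i) + a * C′ m i ≡ a * C′ (suc m) (suc i)
  pascal-term a i = trans
    (solve 3 (λ a x y → a :* y :+ a :* x := a :* (x :+ y)) refl a (C′ m i) (C′ m (suc i)))
    (cong (a *_) (sym (pascal m i)))

Monomial< : ℕ → Fn → Set
Monomial< n f = Σ (Fin n → ℚ) λ c → (m : ℕ) → f m ≡ sum (λ i → c i * ℕ→ℚ (m ^ toℕ i))

Monomial<⇒ΣFin : ∀ {n} {f : Fn} → Monomial< n f →
  Σ (Fin n → ℚ) λ c → (m : ℕ) → f m ≡ ΣFin n (λ i → c i * ℕ→ℚ (m ^ toℕ i))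
Monomial<⇒ΣFin {n} (c , eq) =
  c , λ m → trans (eq m) (sym (ΣFin≡sum n (λ i → c i * ℕ→ℚ (m ^ toℕ i))))

Monomial-cong : ∀ {n} {f g : Fn} → (∀ m → f m ≡ g m) → Monomial< n f → Monomial< n g
Monomial-cong f≗g (c , eq) = c , λ m → trans (sym (f≗g m)) (eq m)

Monomial-zero : ∀ n → Monomial< n (λ _ → 0ℚ)
Monomial-zero n = (λ _ → 0ℚ) , λ m → sym (sum-zero n (λ i → *-zeroˡ (ℕ→ℚ (m ^ toℕ i))))

Monomial-const : ∀ n a → Monomial< (suc n) (λ _ → a)
Monomial-const n a = (a ∷ λ _ → 0ℚ) , λ m →
  trans (solve 1 (λ a → a := a :* con 1ℚ :+ con 0ℚ) refl a)
        (cong (a * 1ℚ +_) (sym (sum-zero n (λ i → *-zeroˡ (ℕ→ℚ (m ^ suc (toℕ i)))))))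

Monomial-+ : ∀ {n} {f g : Fn} → Monomial< n f → Monomial< n g → Monomial< n (λ m → f m + g m)
Monomial-+ (c , eq) (d , eq′) = (λ i → c i + d i) , λ m → trans (cong₂ _+_ (eq m) (eq′ m))
  (sym (trans (sum-cong-≗ (λ i → *-distribʳ-+ (ℕ→ℚ (m ^ toℕ i)) (c i) (d i)))
              (∑-distrib-+ (λ i → c i * ℕ→ℚ (m ^ toℕ i)) (λ i → d i * ℕ→ℚ (m ^ toℕ i)))))

Monomial-scale : ∀ {n} a {f : Fn} → Monomial< n f → Monomial< n (λ m → a * f m)
Monomial-scale a (c , eq) = (λ i → a * c i) , λ m → trans (cong (a *_) (eq m))
  (trans (*-distribˡ-sum a (λ i → c i * ℕ→ℚ (m ^ toℕ i)))
         (sum-cong-≗ (λ i → sym (*-assoc a (c i) (ℕ→ℚ (m ^ toℕ i))))))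

Monomial-sum : ∀ {n} k {h : Fin k → Fn} → (∀ i → Monomial< n (h i)) →
  Monomial< n (λ m → sum (λ i → h i m))
Monomial-sum {n} zero    _ = Monomial-zero n
Monomial-sum     (suc k) H = Monomial-+ (H Fin.zero) (Monomial-sum k (λ i → H (Fin.suc i)))

Monomial-times-m : ∀ {n} {f : Fn} → Monomial< n f → Monomial< (suc n) (λ m → ℕ→ℚ m * f m)
Monomial-times-m {n} {f} (c , eq) = (0ℚ ∷ c) , λ m → begin
    ℕ→ℚ m * f m
  ≡⟨ cong (ℕ→ℚ m *_) (eq m) ⟩
    ℕ→ℚ m * sum (λ i → c i * ℕ→ℚ (m ^ toℕ i))
  ≡⟨ *-distribˡ-sum (ℕ→ℚ m) (λ i → c i * ℕ→ℚ (m ^ toℕ i)) ⟩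
    sum (λ i → ℕ→ℚ m * (c i * ℕ→ℚ (m ^ toℕ i)))
  ≡⟨ sum-cong-≗ (λ i → absorb-m m (c i) (toℕ i)) ⟩
    sum (λ i → c i * ℕ→ℚ (m ^ suc (toℕ i)))
  ≡⟨ solve 1 (λ a → a := con 0ℚ :* con 1ℚ :+ a) refl _ ⟩
    0ℚ * 1ℚ + sum (λ i → c i * ℕ→ℚ (m ^ suc (toℕ i)))
  ∎
  where
  open ≡-Reasoning
  absorb-m : ∀ m a k → ℕ→ℚ m * (a * ℕ→ℚ (m ^ k)) ≡ a * ℕ→ℚ (m ^ suc k)
  absorb-m m a k = trans
    (solve 3 (λ x a y → x :* (a :* y) := a :* (x :* y)) refl (ℕ→ℚ m) a (ℕ→ℚ (m ^ k)))
    (cong (a *_) (sym (ℕ→ℚ-* m (m ^ k))))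

binomial-absorption : ∀ m i → m ℕ.* (m C i) ≡ suc i ℕ.* (m C suc i) ℕ.+ i ℕ.* (m C i)
binomial-absorption zero    zero    = refl
binomial-absorption zero    (suc i) = sym (cong₂ ℕ._+_ (ℕP.*-zeroʳ (suc (suc i))) (ℕP.*-zeroʳ (suc i)))
binomial-absorption (suc m) zero    rewrite nC1≡n (suc m) = unit-law (suc m)
  where
  unit-law : ∀ x → x ℕ.* 1 ≡ 1 ℕ.* x ℕ.+ 0 ℕ.* 1
  unit-law = solve-∀
binomial-absorption (suc m) (suc i)
  rewrite sym (nCk+nC[k+1]≡[n+1]C[k+1] m i) | sym (nCk+nC[k+1]≡[n+1]C[k+1] m (suc i)) = begin
    suc m ℕ.* (x ℕ.+ y)
  ≡⟨ expand m x y ⟩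
    (m ℕ.* x ℕ.+ m ℕ.* y) ℕ.+ (x ℕ.+ y)
  ≡⟨ cong (ℕ._+ (x ℕ.+ y))
          (cong₂ ℕ._+_ (binomial-absorption m i) (binomial-absorption m (suc i))) ⟩
    ((suc i ℕ.* y ℕ.+ i ℕ.* x) ℕ.+ (suc (suc i) ℕ.* z ℕ.+ suc i ℕ.* y)) ℕ.+ (x ℕ.+ y)
  ≡⟨ regroup i x y z ⟩
    suc (suc i) ℕ.* (y ℕ.+ z) ℕ.+ suc i ℕ.* (x ℕ.+ y)
  ∎
  where
  open ≡-Reasoning
  x = m C i
  y = m C suc i
  z = m C suc (suc i)
  expand : ∀ m x y → suc m ℕ.* (x ℕ.+ y) ≡ (m ℕ.* x ℕ.+ m ℕ.* y) ℕ.+ (x ℕ.+ y)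
  expand = solve-∀
  regroup : ∀ i x y z →
    ((suc i ℕ.* y ℕ.+ i ℕ.* x) ℕ.+ (suc (suc i) ℕ.* z ℕ.+ suc i ℕ.* y)) ℕ.+ (x ℕ.+ y)
      ≡ suc (suc i) ℕ.* (y ℕ.+ z) ℕ.+ suc i ℕ.* (x ℕ.+ y)
  regroup = solve-∀

binomial-step : ∀ i r → r * ℕ→ℚ (suc i) ≡ 1ℚ → ∀ m →
  r * (ℕ→ℚ m * ℕ→ℚ (m C i)) + (- (r * ℕ→ℚ i)) * ℕ→ℚ (m C i) ≡ ℕ→ℚ (m C suc i)
binomial-step i r r-inverse m = begin
    r * (ℕ→ℚ m * x) + (- (r * ℕ→ℚ i)) * x
  ≡⟨ cong (λ t → r * t + (- (r * ℕ→ℚ i)) * x) absorption ⟩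
    r * (ℕ→ℚ (suc i) * y + ℕ→ℚ i * x) + (- (r * ℕ→ℚ i)) * x
  ≡⟨ solve 5 (λ r s y j x → r :* (s :* y :+ j :* x) :+ (:- (r :* j)) :* x := (r :* s) :* y) refl
       r (ℕ→ℚ (suc i)) y (ℕ→ℚ i) x ⟩
    (r * ℕ→ℚ (suc i)) * y
  ≡⟨ cong (_* y) r-inverse ⟩
    1ℚ * y
  ≡⟨ solve 1 (λ y → con 1ℚ :* y := y) refl y ⟩
    y
  ∎
  where
  open ≡-Reasoning
  x = ℕ→ℚ (m C i)
  y = ℕ→ℚ (m C suc i)
  absorption : ℕ→ℚ m * x ≡ ℕ→ℚ (suc i) * y + ℕ→ℚ i * x
  absorption = begin
      ℕ→ℚ m * x
    ≡⟨ sym (ℕ→ℚ-* m (m C i)) ⟩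
      ℕ→ℚ (m ℕ.* (m C i))
    ≡⟨ cong ℕ→ℚ (binomial-absorption m i) ⟩
      ℕ→ℚ (suc i ℕ.* (m C suc i) ℕ.+ i ℕ.* (m C i))
    ≡⟨ trans (ℕ→ℚ-+ (suc i ℕ.* (m C suc i)) (i ℕ.* (m C i)))
             (cong₂ _+_ (ℕ→ℚ-* (suc i) (m C suc i)) (ℕ→ℚ-* i (m C i))) ⟩
      ℕ→ℚ (suc i) * y + ℕ→ℚ i * x
    ∎

binomial-monomial : ∀ i n → i < n → Monomial< n (λ m → ℕ→ℚ (m C i))
binomial-monomial zero    (suc n) _         = Monomial-const n 1ℚ
binomial-monomial (suc i) (suc n) (s≤s i<n) with ℕ→ℚ-suc-invertible i
... | r , r-inverse = Monomial-cong
  {f = λ m → r * (ℕ→ℚ m * ℕ→ℚ (m C i)) + (- (r * ℕ→ℚ i)) * ℕ→ℚ (m C i)}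
  (binomial-step i r r-inverse)
  (Monomial-+ (Monomial-scale r (Monomial-times-m (binomial-monomial i n i<n)))
              (Monomial-scale (- (r * ℕ→ℚ i)) (binomial-monomial i (suc n) (ℕP.m<n⇒m<1+n i<n))))

poly⇒monomial : ∀ n {f : Fn} → Poly< n f → Monomial< n f
poly⇒monomial n {f} p = Monomial-cong (λ m → sym (newton n f p m))
  (Monomial-sum n (λ i → Monomial-scale (Δ^ (toℕ i) f 0) (binomial-monomial (toℕ i) n (toℕ<n i))))

oneS-positive : ∀ n i → i < n → oneS (n ∸ i) ≡ 0ℚ
oneS-positive (suc n) zero    _         = refl
oneS-positive (suc n) (suc i) (s≤s i<n) = oneS-positive n i i<n

·S-oneSʳ : ∀ (g : Series) n → (g ·S oneS) n ≡ g n
·S-oneSʳ g n = begin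
    Σ< n (λ i → g i * oneS (n ∸ i)) + g n * oneS (n ∸ n)
  ≡⟨ cong₂ _+_ (Σ<-zero n (λ i i<n → trans (cong (g i *_) (oneS-positive n i i<n)) (*-zeroʳ (g i))))
               (cong (λ k → g n * oneS k) (ℕP.n∸n≡0 n)) ⟩
    0ℚ + g n * 1ℚ
  ≡⟨ solve 1 (λ a → con 0ℚ :+ a :* con 1ℚ := a) refl (g n) ⟩
    g n
  ∎
  where open ≡-Reasoning

-- [x^{n+1}] exp(g) = [x^{n+1}] g + Σ_{k<n} [x^{n+1}] g^{k+2} / (k+2)!: the terms
-- k = 0 and k = 1 of the exponential series contribute 0 and g.
exp-coefficient : ∀ (g : Series) n →
  expS g (suc n) ≡ g (suc n) + Σ< n (λ k → invFact (2 ℕ.+ k) * powS g (2 ℕ.+ k) (suc n))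
exp-coefficient g n = begin
    expS g (suc n)
  ≡⟨ Σ<-head (suc n) term ⟩
    term 0 + Σ< (suc n) (λ k → term (suc k))
  ≡⟨ cong (term 0 +_) (Σ<-head n (λ k → term (suc k))) ⟩
    1ℚ * 0ℚ + (1ℚ * (g ·S oneS) (suc n) + R)
  ≡⟨ cong (λ t → 1ℚ * 0ℚ + (1ℚ * t + R)) (·S-oneSʳ g (suc n)) ⟩
    1ℚ * 0ℚ + (1ℚ * g (suc n) + R)
  ≡⟨ solve 2 (λ a b → con 1ℚ :* con 0ℚ :+ (con 1ℚ :* a :+ b) := a :+ b) refl (g (suc n)) R ⟩
    g (suc n) + R
  ∎
  where
  open ≡-Reasoning
  term : ℕ → ℚ
  term k = invFact k * powS g k (suc n)
  R : ℚ
  R = Σ< n (λ k → term (2 ℕ.+ k))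

-- A family G of series (one for each m) is graded of weight w
-- below N when, for n < w + N, its n-th coefficient has degree ≤ n − w as a
-- function of m (and vanishes for n < w).

Graded : ℕ → ℕ → (ℕ → Series) → Set
Graded w N G = ∀ n → n < w ℕ.+ N → Poly< (suc n ∸ w) (λ m → G m n)

Graded-vanishing : ∀ {w N G} → Graded w N G → ∀ n → n < w → Poly< 0 (λ m → G m n)
Graded-vanishing {w} {N} {G} gG n n<w =
  subst (λ d → Poly< d (λ m → G m n)) (ℕP.m≤n⇒m∸n≡0 n<w)
        (gG n (ℕP.<-≤-trans n<w (ℕP.m≤m+n w N)))

Graded-coefficient : ∀ {w N G} → Graded w N G → ∀ n → w ≤ n → n < w ℕ.+ N →
  Poly< (suc (n ∸ w)) (λ m → G m n)
Graded-coefficient {w} {N} {G} gG n w≤n n< =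
  subst (λ d → Poly< d (λ m → G m n)) (ℕP.+-∸-assoc 1 w≤n) (gG n n<)

summand-bound : ∀ {i j a b N} → b ≤ j → i ℕ.+ j < (a ℕ.+ b) ℕ.+ N → i < a ℕ.+ N
summand-bound {i} {j} {a} {b} {N} b≤j lt = ℕP.+-cancelʳ-< b i (a ℕ.+ N) (begin-strict
    i ℕ.+ b          ≤⟨ ℕP.+-monoʳ-≤ i b≤j ⟩
    i ℕ.+ j          <⟨ lt ⟩
    (a ℕ.+ b) ℕ.+ N  ≡⟨ swap a b N ⟩
    (a ℕ.+ N) ℕ.+ b  ∎)
  where
  open ℕP.≤-Reasoning
  swap : ∀ a b N → (a ℕ.+ b) ℕ.+ N ≡ (a ℕ.+ N) ℕ.+ b
  swap = solve-∀

degree-of-product : ∀ {i j a b} → a ≤ i → b ≤ j →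
  suc ((i ∸ a) ℕ.+ (j ∸ b)) ≡ suc (i ℕ.+ j) ∸ (a ℕ.+ b)
degree-of-product {a = a} {b} a≤i b≤j
  with ℕP.m≤n⇒∃[o]m+o≡n a≤i | ℕP.m≤n⇒∃[o]m+o≡n b≤j
... | x , refl | y , refl = begin
    suc ((a ℕ.+ x ∸ a) ℕ.+ (b ℕ.+ y ∸ b))
  ≡⟨ cong₂ (λ u v → suc (u ℕ.+ v)) (ℕP.m+n∸m≡n a x) (ℕP.m+n∸m≡n b y) ⟩
    suc (x ℕ.+ y)
  ≡⟨ sym (ℕP.m+n∸m≡n (a ℕ.+ b) (suc (x ℕ.+ y))) ⟩
    (a ℕ.+ b) ℕ.+ suc (x ℕ.+ y) ∸ (a ℕ.+ b)
  ≡⟨ cong (_∸ (a ℕ.+ b)) (interchange a b x y) ⟩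
    suc ((a ℕ.+ x) ℕ.+ (b ℕ.+ y)) ∸ (a ℕ.+ b)
  ∎
  where
  open ≡-Reasoning
  interchange : ∀ a b x y → (a ℕ.+ b) ℕ.+ suc (x ℕ.+ y) ≡ suc ((a ℕ.+ x) ℕ.+ (b ℕ.+ y))
  interchange = solve-∀

Graded-·S : ∀ {a b N} {G H : ℕ → Series} → Graded a N G → Graded b N H →
  Graded (a ℕ.+ b) N (λ m → G m ·S H m)
Graded-·S {a} {b} {N} {G} {H} gG gH n n< =
  Poly<-Σ< (suc n ∸ (a ℕ.+ b)) (suc n) {λ i m → G m i * H m (n ∸ i)} summand
  where
  -- The summand G_i·H_{n−i} vanishes unless a ≤ i and b ≤ n − i, in which
  -- case its degree is (i − a) + (n − i − b) = n − (a + b).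
  summand : ∀ i → i < suc n → Poly< (suc n ∸ (a ℕ.+ b)) (λ m → G m i * H m (n ∸ i))
  summand i (s≤s i≤n) with a ℕP.≤? i | b ℕP.≤? n ∸ i
  ... | no a≰i | _      = Poly<-zero-*ˡ {suc n ∸ (a ℕ.+ b)} {λ m → G m i} {λ m → H m (n ∸ i)}
                            (Graded-vanishing {G = G} gG i (ℕP.≰⇒> a≰i))
  ... | yes _  | no b≰j = Poly<-zero-*ʳ {suc n ∸ (a ℕ.+ b)} {λ m → G m i} {λ m → H m (n ∸ i)}
                            (Graded-vanishing {G = H} gH (n ∸ i) (ℕP.≰⇒> b≰j))
  ... | yes a≤i | yes b≤j =
    subst (λ d → Poly< d (λ m → G m i * H m j)) degree
      (Poly<-* (i ∸ a) (j ∸ b) {λ m → G m i} {λ m → H m j}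
        (Graded-coefficient {G = G} gG i a≤i (summand-bound {i} {j} {a} {b} {N} b≤j i+j<))
        (Graded-coefficient {G = H} gH j b≤j (summand-bound {j} {i} {b} {a} {N} a≤i j+i<)))
    where
    j = n ∸ i
    i+j≡n : i ℕ.+ j ≡ n
    i+j≡n = ℕP.m+[n∸m]≡n i≤n
    i+j< : i ℕ.+ j < (a ℕ.+ b) ℕ.+ N
    i+j< = subst (_< (a ℕ.+ b) ℕ.+ N) (sym i+j≡n) n<
    j+i< : j ℕ.+ i < (b ℕ.+ a) ℕ.+ N
    j+i< = subst₂ _<_ (ℕP.+-comm i j) (cong (ℕ._+ N) (ℕP.+-comm a b)) i+j<
    degree : suc ((i ∸ a) ℕ.+ (j ∸ b)) ≡ suc n ∸ (a ℕ.+ b)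
    degree = trans (degree-of-product a≤i b≤j) (cong (λ t → suc t ∸ (a ℕ.+ b)) i+j≡n)

Graded-pow : ∀ {N} {G : ℕ → Series} → Graded 1 N G → ∀ k → Graded k N (λ m → powS (G m) k)
Graded-pow         gG zero    n _ =
  Poly<-mono {1} {suc n} {λ _ → oneS n} (s≤s z≤n) (Poly<-const (oneS n))
Graded-pow {N} {G} gG (suc k)     =
  Graded-·S {1} {k} {N} {G} {λ m → powS (G m) k} gG (Graded-pow gG k)

F : ℕ → Series
F m = E m −S oneS

E-constant-term : ∀ m → E m 0 ≡ 1ℚ
E-constant-term zero    = refl
E-constant-term (suc m) = refl

F-constant-term : ∀ m → F m 0 ≡ 0ℚ
F-constant-term m = cong (_- 1ℚ) (E-constant-term m)

F-difference : ∀ n m →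
  Δ (λ m → F m (suc n)) m ≡ Σ< n (λ k → invFact (2 ℕ.+ k) * powS (F m) (2 ℕ.+ k) (suc n))
F-difference n m = begin
    (expS (F m) (suc n) - 0ℚ) - F m (suc n)
  ≡⟨ cong (λ t → (t - 0ℚ) - F m (suc n)) (exp-coefficient (F m) n) ⟩
    ((F m (suc n) + R) - 0ℚ) - F m (suc n)
  ≡⟨ solve 2 (λ a b → ((a :+ b) :- con 0ℚ) :- a := b) refl (F m (suc n)) R ⟩
    R
  ∎
  where
  open ≡-Reasoning
  R : ℚ
  R = Σ< n (λ k → invFact (2 ℕ.+ k) * powS (F m) (2 ℕ.+ k) (suc n))

-- If the coefficients of index ≤ N have the right degree, so does the next one:
-- each [x^{N+1}] F_m^{k+2} has degree ≤ N − k − 1 < N.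
F-coefficient-step : ∀ N → Graded 1 N F → Poly< (suc N) (λ m → F m (suc N))
F-coefficient-step N gF = Poly<-cong N (λ m → sym (F-difference N m))
  (Poly<-Σ< N N (λ k _ → Poly<-scale N (invFact (2 ℕ.+ k))
    (Poly<-mono (ℕP.m∸n≤m N k)
      (Graded-pow gF (2 ℕ.+ k) (suc N) (s≤s (s≤s (ℕP.m≤n+m N k)))))))

F-graded : ∀ N → Graded 1 N F
F-graded zero    zero    _         = F-constant-term
F-graded zero    (suc n) (s≤s ())
F-graded (suc N) n (s≤s n≤N+1) with ℕP.m≤n⇒m<n∨m≡n n≤N+1
... | inj₁ n<N+1 = F-graded N n n<N+1
... | inj₂ refl  = F-coefficient-step N (F-graded N)

Bell-poly : ∀ n → Poly< (suc n) (λ m → Bell m (suc n))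
Bell-poly n = Poly<-scale (suc n) (ℕ→ℚ (suc n !)) {λ m → E m (suc n)}
  (Poly<-cong (suc n) {λ m → F m (suc n)} {λ m → E m (suc n)} F≡E
    (F-coefficient-step n (F-graded n)))
  where
  F≡E : ∀ m → F m (suc n) ≡ E m (suc n)
  F≡E m = solve 1 (λ a → a :- con 0ℚ := a) refl (E m (suc n))

lemma1 : (n : ℕ) → 1 ≤ n →
    Σ (Fin n → ℚ) λ c →
      (m : ℕ) → Bell m n ≡ ΣFin n (λ i → c i * ℕ→ℚ (m ^ toℕ i))
lemma1 (suc n) _ = Monomial<⇒ΣFin (poly⇒monomial (suc n) (Bell-poly n))
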